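{- Let $G$ be a finite simple connected undirected graph with maximum degree $\Delta$, and let $r$ be an integer with $1 \leq r \leq \Delta$. Suppose $S \subseteq V(G)$ is a set with the following two properties: (i) every $u \in S$ satisfies $d(u) \leq r$; (ii) for any two distinct vertices $u_1,u_2 \in S$, either $u_1u_2 \in E(G)$, or there exists $u_3 \in S$ with $u_1,u_2 \in N_G(u_3)$ (or both). Then $\chi_r(G) \geq |S|$.
   Context: For a vertex $v$, $N_G(v)=\{u : uv \in E(G)\}$ and $d(v)=|N_G(v)|$; for $S\subseteq V(G)$ and a map $c$, $c(S)=\{c(u):u\in S\}$. For integers $k>0$, $r>0$, a conditional $(k,r)$-coloring of $G$ is a surjective map $c\colon V(G)\to\{1,\ldots,k\}$ such that (C1) $c(u)\neq c(v)$ whenever $uv\in E(G)$, and (C2) $|c(N_G(v))|\geq \min\{d(v),r\}$ for every $v\in V(G)$. The $r$th order conditional chromatic number $\chi_r(G)$ is the smallest $k$ for which $G$ has a conditional $(k,r)$-coloring. A set $S$ with properties (i) and (ii) is called a Vset-$d2r$. -}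

module Defs where

open import Data.Nat using (ℕ; zero; suc; _≤_; _⊔_; _⊓_)
open import Data.Bool using (Bool; true; false)
import Data.Bool
open import Data.Fin using (Fin; _≟_)
open import Data.Fin.Subset using (Subset; _∈_; ∣_∣)
open import Data.List using (List; []; _∷_; filter; length; foldr; map)
open import Data.Bool.ListAction using (any)
open import Data.List using () renaming (allFin to allFinL)
open import Data.Product using (Σ; ∃; _×_; _,_)
open import Data.Sum using (_⊎_)
open import Relation.Binary.PropositionalEquality using (_≡_; _≢_)
open import Relation.Nullary.Decidable using (⌊_⌋)
open import Function using (_∘_)

record SimpleGraph (n : ℕ) : Set where
  field
    adj     : Fin n → Fin n → Bool
    symm    : ∀ u v → adj u v ≡ adj v u
    irrefl  : ∀ v → adj v v ≡ false
open SimpleGraph public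

module _ {n : ℕ} (G : SimpleGraph n) where

  Edge : Fin n → Fin n → Set
  Edge u v = adj G u v ≡ true

  nbrs : Fin n → List (Fin n)
  nbrs v = filter (λ u → adj G v u Data.Bool.≟ true) (allFinL n)

  deg : Fin n → ℕ
  deg v = length (nbrs v)

  maxDeg : ℕ
  maxDeg = foldr _⊔_ 0 (map deg (allFinL n))

  data Reach : Fin n → Fin n → Set where
    here  : ∀ {u} → Reach u u
    step  : ∀ {u v w} → Edge u v → Reach v w → Reach u w

  Connected : Set
  Connected = Σ ℕ (λ m → n ≡ suc m) × (∀ u v → Reach u v)

  nbrColours : ∀ {k} → (Fin n → Fin k) → Fin n → ℕ
  nbrColours {k} c v =
    length (filter (λ j → any (λ u → ⌊ c u ≟ j ⌋) (nbrs v) Data.Bool.≟ true) (allFinL k))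

  -- conditional (k,r)-colouring (colours 1..k represented by Fin k)
  record CondColouring (k r : ℕ) (c : Fin n → Fin k) : Set where
    field
      surj   : ∀ (j : Fin k) → ∃ λ v → c v ≡ j
      proper : ∀ u v → Edge u v → c u ≢ c v
      cond   : ∀ v → deg v ⊓ r ≤ nbrColours c v

  -- "χ_r(G) ≥ m": every conditional (k,r)-colouring uses at least m colours,
  -- i.e. the minimum k is ≥ m.
  ChiRGe : ℕ → ℕ → Set
  ChiRGe r m = ∀ k (c : Fin n → Fin k) → CondColouring k r c → m ≤ k

  record VsetD2r (r : ℕ) (S : Subset n) : Set where
    field
      degBound : ∀ u → u ∈ S → deg u ≤ r
      close    : ∀ u₁ u₂ → u₁ ∈ S → u₂ ∈ S → u₁ ≢ u₂ →
                 Edge u₁ u₂ ⊎ (∃ λ u₃ → u₃ ∈ S × Edge u₃ u₁ × Edge u₃ u₂)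

-- Let c be a conditional (k,r)-colouring. For u ∈ S we have d(u) ≤ r, so (C2) forces
-- |c(N(u))| ≥ d(u): c is injective on N(u). Two distinct vertices of S are either adjacent, and
-- then coloured differently by (C1), or are two neighbours of some u ∈ S, and then coloured
-- differently by the injectivity on N(u). So c is injective on S, and |S| ≤ k.
module Submission where

open import Defs
open import Data.Nat using (ℕ; _≤_)
open import Data.Fin.Subset using (Subset; ∣_∣)

open import Data.Nat using (suc; _<_; z≤n; s≤s)
open import Data.Bool using (true; false)
import Data.Bool as Bool
open import Data.Bool.ListAction using (any)
open import Data.Bool.Properties using (T-≡; ∨-zeroʳ)
open import Data.Fin using (Fin; suc; _≟_)
open import Data.Fin.Subset using (inside; outside) renaming (_∈_ to _∈ₛ_)
open import Data.Fin.Subset.Properties using (_∈?_)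
open import Data.List using (List; []; _∷_; filter; length; map; allFin; tabulate)
open import Data.Vec using ([]; _∷_)
open import Data.List.Properties using (length-filter; filter-none; length-tabulate; length-map; map-tabulate)
open import Data.List.Membership.Propositional using (_∈_; find)
open import Data.List.Membership.Propositional.Properties using (∈-filter⁺; ∈-filter⁻; ∈-allFin)
open import Data.List.Relation.Unary.All as All using (All; []; _∷_)
open import Data.List.Relation.Unary.AllPairs using ([]; _∷_)
import Data.List.Relation.Unary.Any as Any
open import Data.List.Relation.Unary.Any using (here; there)
open import Data.List.Relation.Unary.Any.Properties using (any⁺; any⁻)
open import Data.List.Relation.Unary.Unique.Propositional using (Unique)
import Data.List.Relation.Unary.Unique.Propositional.Properties as Unique
open import Data.Nat.Properties using (≤-trans; ≤-reflexive; m≤n⇒m≤1+n; m≤n⇒m⊓n≡m; <⇒≱; module ≤-Reasoning)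
open import Data.Product using (∃; _×_; _,_; proj₂)
open import Data.Sum using (_⊎_; inj₁; inj₂; [_,_]′)
open import Function using (id; _∘_; Equivalence)
open import Relation.Nullary using (¬_; yes; no; contradiction)
open import Relation.Nullary.Decidable using (⌊_⌋; does; toWitness; fromWitness)
open import Relation.Unary using (Pred; Decidable; _⊆_)
open import Relation.Binary.PropositionalEquality using (_≡_; _≢_; refl; sym; trans; cong; subst; module ≡-Reasoning)

module _ {a p q} {A : Set a} {P : Pred A p} {Q : Pred A q} (P? : Decidable P) (Q? : Decidable Q) where

  filter-length-mono : ∀ {xs} → All (λ x → P x → Q x) xs →
                       length (filter P? xs) ≤ length (filter Q? xs)
  filter-length-mono [] = z≤n
  filter-length-mono {x ∷ xs} (P⇒Q ∷ rest) with ih ← filter-length-mono rest | P? x | Q? x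
  ... | yes _  | yes _  = s≤s ih
  ... | yes px | no ¬qx = contradiction (P⇒Q px) ¬qx
  ... | no _   | yes _  = m≤n⇒m≤1+n ih
  ... | no _   | no _   = ih

module _ {a p q} {A : Set a} {P : Pred A p} {Q : Pred A q} (P? : Decidable P) (Q? : Decidable Q) where

  filter-length-≤-suc : ∀ {y} → (∀ {x} → P x → Q x ⊎ x ≡ y) →
                        ∀ {xs} → Unique xs → length (filter P? xs) ≤ suc (length (filter Q? xs))
  filter-length-≤-suc P⊆Q∪y [] = z≤n
  filter-length-≤-suc P⊆Q∪y {x ∷ xs} (x∉xs ∷ uniq)
    with ih ← filter-length-≤-suc P⊆Q∪y uniq | P? x | Q? x
  ... | yes _  | yes _  = s≤s ih
  ... | no _   | yes _  = m≤n⇒m≤1+n ih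
  ... | no _   | no _   = ih
  ... | yes px | no ¬qx with P⊆Q∪y px
  ...   | inj₁ qx   = contradiction qx ¬qx
  ...   | inj₂ refl = s≤s (filter-length-mono P? Q? (All.map P⇒Q x∉xs))
    where
    P⇒Q : ∀ {z} → x ≢ z → P z → Q z
    P⇒Q x≢z pz = [ id , (λ z≡x → contradiction (sym z≡x) x≢z) ]′ (P⊆Q∪y pz)

  filter-length-< : Q ⊆ P → ∀ {x xs} → x ∈ xs → P x → ¬ Q x →
                    length (filter Q? xs) < length (filter P? xs)
  filter-length-< Q⊆P {xs = x ∷ xs} (here refl) px ¬qx with P? x | Q? x
  ... | _      | yes qx = contradiction qx ¬qx
  ... | no ¬px | no _   = contradiction px ¬px
  ... | yes _  | no _   = s≤s (filter-length-mono Q? P? (All.universal (λ _ → Q⊆P) xs))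
  filter-length-< Q⊆P {xs = y ∷ xs} (there x∈xs) px ¬qx
    with ih ← filter-length-< Q⊆P x∈xs px ¬qx | P? y | Q? y
  ... | yes _  | yes _  = s≤s ih
  ... | yes _  | no _   = m≤n⇒m≤1+n ih
  ... | no ¬py | yes qy = contradiction (Q⊆P qy) ¬py
  ... | no _   | no _   = ih

module Image {a k} {A : Set a} (f : A → Fin k) where

  -- image f xs lists f(xs) in increasing order; the Boolean membership test is the one of
  -- nbrColours, so that nbrColours G c v is definitionally length (image c (nbrs G v)).
  Hits : List A → Fin k → Set
  Hits xs j = any (λ x → ⌊ f x ≟ j ⌋) xs ≡ true

  hits? : ∀ xs → Decidable (Hits xs)
  hits? xs j = any (λ x → ⌊ f x ≟ j ⌋) xs Bool.≟ true

  image : List A → List (Fin k)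
  image xs = filter (hits? xs) (allFin k)

  hits⁺ : ∀ {x xs} → x ∈ xs → Hits xs (f x)
  hits⁺ x∈xs = Equivalence.to T-≡ (any⁺ _ (Any.map (λ { refl → fromWitness refl }) x∈xs))

  hits⁻ : ∀ {xs j} → Hits xs j → ∃ λ x → x ∈ xs × f x ≡ j
  hits⁻ h with x , x∈xs , fx≟j ← find (any⁻ _ _ (Equivalence.from T-≡ h)) =
    x , x∈xs , toWitness fx≟j

  hits-∷⁺ : ∀ {x xs j} → Hits xs j → Hits (x ∷ xs) j
  hits-∷⁺ h = trans (cong (_ Bool.∨_) h) (∨-zeroʳ _)

  hits-∷⁻ : ∀ {x xs j} → Hits (x ∷ xs) j → Hits xs j ⊎ j ≡ f x
  hits-∷⁻ {x} {j = j} h with f x ≟ j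
  ... | yes fx≡j = inj₂ (sym fx≡j)
  ... | no _     = inj₁ h

  length-image-∷ : ∀ x xs → length (image (x ∷ xs)) ≤ suc (length (image xs))
  length-image-∷ x xs =
    filter-length-≤-suc (hits? (x ∷ xs)) (hits? xs) (hits-∷⁻ {x} {xs}) (Unique.allFin⁺ k)

  length-image-∷-hit : ∀ x xs → Hits xs (f x) → length (image (x ∷ xs)) ≤ length (image xs)
  length-image-∷-hit x xs fx-hit =
    filter-length-mono (hits? (x ∷ xs)) (hits? xs) (All.universal (λ _ → hits-∷⁻-hit) (allFin k))
    where
    hits-∷⁻-hit : ∀ {j} → Hits (x ∷ xs) j → Hits xs j
    hits-∷⁻-hit h = [ id , (λ { refl → fx-hit }) ]′ (hits-∷⁻ {x} {xs} h)

  length-image-∷-fresh : ∀ x xs → ¬ Hits xs (f x) → suc (length (image xs)) ≤ length (image (x ∷ xs))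
  length-image-∷-fresh x xs fresh =
    filter-length-< (hits? (x ∷ xs)) (hits? xs) (hits-∷⁺ {x} {xs})
                    (∈-allFin (f x)) (hits⁺ {xs = x ∷ xs} (here refl)) fresh

  length-image≤length : ∀ xs → length (image xs) ≤ length xs
  length-image≤length [] =
    ≤-reflexive (cong length (filter-none (hits? []) (All.universal (λ _ ()) (allFin k))))
  length-image≤length (x ∷ xs) = ≤-trans (length-image-∷ x xs) (s≤s (length-image≤length xs))

  length-image≤k : ∀ xs → length (image xs) ≤ k
  length-image≤k xs = ≤-trans (length-filter (hits? xs) (allFin k)) (≤-reflexive (length-tabulate id))

  collision⇒length-image< : ∀ {x y xs} → x ∈ xs → y ∈ xs → x ≢ y → f x ≡ f y →
                            length (image xs) < length xs
  collision⇒length-image< (here refl) (here refl) x≢y _ = contradiction refl x≢y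
  collision⇒length-image< {xs = x ∷ xs} (here refl) (there y∈xs) _ fx≡fy =
    s≤s (≤-trans (length-image-∷-hit x xs (subst (Hits xs) (sym fx≡fy) (hits⁺ {xs = xs} y∈xs)))
                 (length-image≤length xs))
  collision⇒length-image< {xs = y ∷ xs} (there x∈xs) (here refl) _ fx≡fy =
    s≤s (≤-trans (length-image-∷-hit y xs (subst (Hits xs) fx≡fy (hits⁺ {xs = xs} x∈xs)))
                 (length-image≤length xs))
  collision⇒length-image< {xs = z ∷ xs} (there x∈xs) (there y∈xs) x≢y fx≡fy =
    ≤-trans (s≤s (length-image-∷ z xs)) (s≤s (collision⇒length-image< x∈xs y∈xs x≢y fx≡fy))

  injectiveOn⇒length≤length-image : ∀ {xs} → Unique xs →
    (∀ {x y} → x ∈ xs → y ∈ xs → f x ≡ f y → x ≡ y) → length xs ≤ length (image xs)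
  injectiveOn⇒length≤length-image [] _ = z≤n
  injectiveOn⇒length≤length-image {x ∷ xs} (x∉xs ∷ uniq) inj =
    ≤-trans (s≤s (injectiveOn⇒length≤length-image uniq (λ x∈ y∈ → inj (there x∈) (there y∈))))
            (length-image-∷-fresh x xs fresh)
    where
    fresh : ¬ Hits xs (f x)
    fresh h with y , y∈xs , fy≡fx ← hits⁻ {xs} h =
      All.lookup x∉xs y∈xs (inj (here refl) (there y∈xs) (sym fy≡fx))

elements : ∀ {n} → Subset n → List (Fin n)
elements {n} p = filter (_∈? p) (allFin n)

elements-unique : ∀ {n} (p : Subset n) → Unique (elements p)
elements-unique {n} p = Unique.filter⁺ (_∈? p) (Unique.allFin⁺ n)

∈-elements⁻ : ∀ {n x} (p : Subset n) → x ∈ elements p → x ∈ₛ p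
∈-elements⁻ {n} p x∈ = proj₂ (∈-filter⁻ (_∈? p) {xs = allFin n} x∈)

filter-∈?-map-suc : ∀ {n} s (p : Subset n) xs →
                    filter (_∈? s ∷ p) (map suc xs) ≡ map suc (filter (_∈? p) xs)
filter-∈?-map-suc s p [] = refl
filter-∈?-map-suc s p (x ∷ xs) with does (x ∈? p)
... | true  = cong (suc x ∷_) (filter-∈?-map-suc s p xs)
... | false = filter-∈?-map-suc s p xs

length-filter-∈?-tabulate-suc : ∀ {n} s (p : Subset n) →
                                length (filter (_∈? s ∷ p) (tabulate suc)) ≡ length (elements p)
length-filter-∈?-tabulate-suc {n} s p = begin
  length (filter (_∈? s ∷ p) (tabulate suc))       ≡⟨ cong (length ∘ filter (_∈? s ∷ p)) (map-tabulate id suc) ⟨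
  length (filter (_∈? s ∷ p) (map suc (allFin n))) ≡⟨ cong length (filter-∈?-map-suc s p (allFin n)) ⟩
  length (map suc (elements p))                    ≡⟨ length-map suc (elements p) ⟩
  length (elements p)                              ∎
  where open ≡-Reasoning

length-elements : ∀ {n} (p : Subset n) → length (elements p) ≡ ∣ p ∣
length-elements [] = refl
length-elements (inside ∷ p)  =
  cong suc (trans (length-filter-∈?-tabulate-suc inside p) (length-elements p))
length-elements (outside ∷ p) = trans (length-filter-∈?-tabulate-suc outside p) (length-elements p)

module _ {n} (G : SimpleGraph n) where

  ∈-nbrs⁺ : ∀ {v u} → Edge G v u → u ∈ nbrs G v
  ∈-nbrs⁺ {v} {u} vu = ∈-filter⁺ (λ w → adj G v w Bool.≟ true) (∈-allFin u) vu

  module _ {k r} {c : Fin n → Fin k} (cc : CondColouring G k r c) where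
    open CondColouring cc
    open Image c

    injectiveOn-nbrs : ∀ {v u₁ u₂} → deg G v ≤ r →
                             u₁ ∈ nbrs G v → u₂ ∈ nbrs G v → c u₁ ≡ c u₂ → u₁ ≡ u₂
    injectiveOn-nbrs {v} {u₁} {u₂} dv≤r u₁∈ u₂∈ cu₁≡cu₂ with u₁ ≟ u₂
    ... | yes u₁≡u₂ = u₁≡u₂
    ... | no u₁≢u₂  =
      contradiction deg≤colours (<⇒≱ (collision⇒length-image< u₁∈ u₂∈ u₁≢u₂ cu₁≡cu₂))
      where
      deg≤colours : deg G v ≤ nbrColours G c v
      deg≤colours = subst (_≤ nbrColours G c v) (m≤n⇒m⊓n≡m dv≤r) (cond v)

    injectiveOn-Vset : ∀ {S u₁ u₂} → VsetD2r G r S →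
                             u₁ ∈ₛ S → u₂ ∈ₛ S → c u₁ ≡ c u₂ → u₁ ≡ u₂
    injectiveOn-Vset {u₁ = u₁} {u₂} V u₁∈S u₂∈S cu₁≡cu₂ with u₁ ≟ u₂
    ... | yes u₁≡u₂ = u₁≡u₂
    ... | no u₁≢u₂ with VsetD2r.close V u₁ u₂ u₁∈S u₂∈S u₁≢u₂
    ...   | inj₁ u₁u₂ = contradiction cu₁≡cu₂ (proper u₁ u₂ u₁u₂)
    ...   | inj₂ (u₃ , u₃∈S , u₃u₁ , u₃u₂) =
      injectiveOn-nbrs (VsetD2r.degBound V u₃ u₃∈S) (∈-nbrs⁺ u₃u₁) (∈-nbrs⁺ u₃u₂) cu₁≡cu₂

lemma1 : ∀ {n : ℕ} (G : SimpleGraph n) → Connected G →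
         ∀ (r : ℕ) → 1 ≤ r → r ≤ maxDeg G →
         ∀ (S : Subset n) → VsetD2r G r S →
         ChiRGe G r ∣ S ∣
lemma1 G _ r _ _ S V k c cc = begin
  ∣ S ∣                       ≡⟨ length-elements S ⟨
  length (elements S)         ≤⟨ injectiveOn⇒length≤length-image (elements-unique S) c-injective-on-S ⟩
  length (image (elements S)) ≤⟨ length-image≤k (elements S) ⟩
  k                           ∎
  where
  open Image c
  open ≤-Reasoning
  c-injective-on-S : ∀ {u₁ u₂} → u₁ ∈ elements S → u₂ ∈ elements S → c u₁ ≡ c u₂ → u₁ ≡ u₂
  c-injective-on-S u₁∈ u₂∈ = injectiveOn-Vset G cc V (∈-elements⁻ S u₁∈) (∈-elements⁻ S u₂∈)
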